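{- For every $m\ge1$ there exists a finite subset $S_m\subset O(\mathbb{R}^4)$ such that $$\tfrac{1}{\sqrt{2m}}(D_4)_{2m}=\bigsqcup_{\sigma\in S_m}\sigma\big(\tfrac{1}{\sqrt2}\mathbf{D}_4\big),$$ a disjoint union.
   Context: $D_4=\{x\in\mathbb{Z}^4: x_1+x_2+x_3+x_4\equiv0\bmod2\}$ and $(D_4)_n=\{x\in D_4: x_1^2+\dots+x_4^2=n\}$; $cY=\{cy:y\in Y\}$. $\mathbf{D}_4=(D_4)_2$ is the $D_4$ root system, consisting of the 24 permutations of $(\pm1,\pm1,0,0)$. $O(\mathbb{R}^4)$ is the orthogonal group of $\mathbb{R}^4$. -}

module Defs where

open import Data.Nat using (ℕ)
open import Data.Fin using (Fin; zero; suc)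
open import Data.Integer as ℤ using (ℤ; +_)
open import Data.Integer.Divisibility using (_∣_)
open import Data.Rational as ℚ using (ℚ)
open import Relation.Binary.PropositionalEquality using (_≡_)

Vec4 : Set → Set
Vec4 A = Fin 4 → A

Mat4 : Set
Mat4 = Fin 4 → Fin 4 → ℚ

i0 i1 i2 i3 : Fin 4
i0 = zero
i1 = suc zero
i2 = suc (suc zero)
i3 = suc (suc (suc zero))

sum4ℤ : (Fin 4 → ℤ) → ℤ
sum4ℤ f = f i0 ℤ.+ f i1 ℤ.+ f i2 ℤ.+ f i3

sum4ℚ : (Fin 4 → ℚ) → ℚ
sum4ℚ f = f i0 ℚ.+ f i1 ℚ.+ f i2 ℚ.+ f i3

InD4 : Vec4 ℤ → Set
InD4 x = (+ 2) ∣ sum4ℤ x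

InD4Shell : ℕ → Vec4 ℤ → Set
InD4Shell n x = InD4 x × (sum4ℤ (λ i → x i ℤ.* x i) ≡ + n)
  where open import Data.Product using (_×_)

toℚ : ℤ → ℚ
toℚ z = z ℚ./ 1

apply : Mat4 → Vec4 ℤ → Vec4 ℚ
apply M x i = sum4ℚ (λ j → M i j ℚ.* toℚ (x j))

-- Mᵀ M = m · I, i.e. M / √m ∈ O(ℝ⁴)
ScaledOrth : ℕ → Mat4 → Set
ScaledOrth m M = ∀ i j → sum4ℚ (λ k → M k i ℚ.* M k j) ≡ δ i j
  where
  open import Data.Fin using (_≟_)
  open import Relation.Nullary using (yes; no)
  δ : Fin 4 → Fin 4 → ℚ
  δ i j with i ≟ j
  ... | yes _ = (+ m) ℚ./ 1
  ... | no _ = ℚ.0ℚ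

{-# OPTIONS --safe #-}
-- Identify ℤ⁴ with the Lipschitz quaternions. Left multiplication by a quaternion a of norm m
-- is √m times an orthogonal map, and it sends the 24 roots (the quaternions of norm 2) into
-- (D₄)_{2m}, because D₄ consists exactly of the integral quaternions of even norm.
-- Conversely every y ∈ (D₄)_{2m} factors as y = a · r with norm a = m and r ∈ {1+i, 1+j, 1+k},
-- the choice of r depending on which pairing of the coordinates of y has even sums.
-- Two orbits a · roots and b · roots are equal or disjoint: if b · x = a · x′ for roots x, x′,
-- then a · r = b · w with 2w = x · x̄′ · r, and w is again a root (a finite check).
-- Walking through the finite shell and keeping a factor of every y not yet covered therefore
-- produces the required disjoint family.
module Submission where

open import Defs
open import Data.Nat using (ℕ; _≤_)
open import Data.Fin using (Fin)
open import Data.Integer using (ℤ)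
open import Data.Product using (Σ; ∃; _×_)
open import Relation.Nullary using (¬_)
open import Relation.Binary.PropositionalEquality using (_≡_; _≢_)

open import Algebra.Bundles.Raw using (RawRing)
open import Data.Fin using (zero; suc; #_; _≟_)
open import Data.Integer as ℤ using (+_; -[1+_]; 0ℤ; 1ℤ; -1ℤ)
import Data.Integer.DivMod as ℤ
open import Data.Integer.Divisibility.Signed
  using (_∣_; divides; ∣⇒∣ᵤ; ∣ᵤ⇒∣; ∣-refl; ∣m∣n⇒∣m+n; ∣m∣n⇒∣m-n; ∣m+n∣m⇒∣n; ∣m⇒∣m*n; ∣n⇒∣m*n)
import Data.Integer.Properties as ℤ
open import Data.Integer.Tactic.RingSolver using (ring; solve-∀; solve)
open import Data.List as List
  using (List; []; _∷_; _++_; map; upTo; foldr; cartesianProduct; cartesianProductWith; length)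
open import Data.List.Membership.Propositional using (_∈_; find; lose)
open import Data.List.Membership.Propositional.Properties
  using (∈-++⁺ˡ; ∈-++⁺ʳ; ∈-map⁺; ∈-upTo⁺; ∈-cartesianProductWith⁺; ∈-lookup)
open import Data.List.Relation.Unary.All as All using (All; []; _∷_)
open import Data.List.Relation.Unary.AllPairs using (AllPairs; []; _∷_)
open import Data.List.Relation.Unary.Any as Any using (Any; here; there)
open import Data.List.Relation.Unary.Any.Properties using (lookup-index)
import Data.Nat as ℕ
import Data.Nat.Properties as ℕ
open import Data.Nat.Coprimality using (1-coprimeTo) renaming (sym to Coprime-sym)
open import Data.Product using (_,_; proj₁; proj₂)
import Data.Rational as ℚ
import Data.Rational.Properties as ℚ
open import Data.Sum using (_⊎_; inj₁; inj₂)
open import Data.Unit using (tt)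
open import Data.Vec as Vec using (Vec; []; _∷_; concat)
open import Function using (_∘_)
open import Level using (0ℓ)
open import Relation.Binary.Definitions using (Symmetric)
open import Relation.Binary.PropositionalEquality
  using (refl; sym; trans; cong; cong₂; subst; module ≡-Reasoning)
open import Relation.Nullary using (Dec; yes; no; contradiction)
open import Relation.Nullary.Decidable using (toWitness; _→-dec_)
open import Tactic.RingSolver.Core.Expression using (Expr; Κ; Ι; _⊕_; _⊗_; ⊝_)
open import Tactic.RingSolver.NonReflective ring using (module Ops)
open Ops using (⟦_⟧; ⟦_⇓⟧; prove)

record ℍ (A : Set) : Set where
  constructor ⟨_,_,_,_⟩
  field re imᵢ imⱼ imₖ : A

coord : ∀ {A} → ℍ A → Vec4 A
coord x zero = ℍ.re x
coord x (suc zero) = ℍ.imᵢ x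
coord x (suc (suc zero)) = ℍ.imⱼ x
coord x (suc (suc (suc zero))) = ℍ.imₖ x

toℍ : ∀ {A} → Vec4 A → ℍ A
toℍ x = ⟨ x i0 , x i1 , x i2 , x i3 ⟩

coord-toℍ : ∀ {A} (x : Vec4 A) c → coord (toℍ x) c ≡ x c
coord-toℍ x zero = refl
coord-toℍ x (suc zero) = refl
coord-toℍ x (suc (suc zero)) = refl
coord-toℍ x (suc (suc (suc zero))) = refl

coord-injective : ∀ {A} {x y : ℍ A} → (∀ c → coord x c ≡ coord y c) → x ≡ y
coord-injective x≗y with x≗y i0 | x≗y i1 | x≗y i2 | x≗y i3
... | refl | refl | refl | refl = refl

infix 4 _≟ℍ_
_≟ℍ_ : (x y : ℍ ℤ) → Dec (x ≡ y)
⟨ x₀ , x₁ , x₂ , x₃ ⟩ ≟ℍ ⟨ y₀ , y₁ , y₂ , y₃ ⟩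
  with x₀ ℤ.≟ y₀ | x₁ ℤ.≟ y₁ | x₂ ℤ.≟ y₂ | x₃ ℤ.≟ y₃
... | yes refl | yes refl | yes refl | yes refl = yes refl
... | no x₀≢y₀ | _ | _ | _ = no λ x≡y → x₀≢y₀ (cong ℍ.re x≡y)
... | yes _ | no x₁≢y₁ | _ | _ = no λ x≡y → x₁≢y₁ (cong ℍ.imᵢ x≡y)
... | yes _ | yes _ | no x₂≢y₂ | _ = no λ x≡y → x₂≢y₂ (cong ℍ.imⱼ x≡y)
... | yes _ | yes _ | yes _ | no x₃≢y₃ = no λ x≡y → x₃≢y₃ (cong ℍ.imₖ x≡y)

-- Stated over a raw ring so that the same formulas can also be instantiated at polynomial
-- expressions, on which the ring solver then checks quaternion identities coordinatewise.
module ℍ-Operations (R : RawRing 0ℓ 0ℓ) where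
  open RawRing R

  infixl 6 _-_
  infixl 7 _·_
  infixr 7 _⋆_

  private
    _-_ : Carrier → Carrier → Carrier
    x - y = x + - y

  scalar : Carrier → ℍ Carrier
  scalar a = ⟨ a , 0# , 0# , 0# ⟩

  _⋆_ : Carrier → ℍ Carrier → ℍ Carrier
  a ⋆ ⟨ x₀ , x₁ , x₂ , x₃ ⟩ = ⟨ a * x₀ , a * x₁ , a * x₂ , a * x₃ ⟩

  conj : ℍ Carrier → ℍ Carrier
  conj ⟨ x₀ , x₁ , x₂ , x₃ ⟩ = ⟨ x₀ , - x₁ , - x₂ , - x₃ ⟩

  _·_ : ℍ Carrier → ℍ Carrier → ℍ Carrier
  ⟨ a₀ , a₁ , a₂ , a₃ ⟩ · ⟨ b₀ , b₁ , b₂ , b₃ ⟩ = ⟨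
    a₀ * b₀ - a₁ * b₁ - a₂ * b₂ - a₃ * b₃ ,
    a₀ * b₁ + a₁ * b₀ + a₂ * b₃ - a₃ * b₂ ,
    a₀ * b₂ - a₁ * b₃ + a₂ * b₀ + a₃ * b₁ ,
    a₀ * b₃ + a₁ * b₂ - a₂ * b₁ + a₃ * b₀ ⟩

  Σ₄ : (Fin 4 → Carrier) → Carrier
  Σ₄ f = f i0 + f i1 + f i2 + f i3

  dot : ℍ Carrier → ℍ Carrier → Carrier
  dot x y = Σ₄ λ c → coord x c * coord y c

  norm : ℍ Carrier → Carrier
  norm x = dot x x

  basis : Fin 4 → ℍ Carrier
  basis zero = ⟨ 1# , 0# , 0# , 0# ⟩
  basis (suc zero) = ⟨ 0# , 1# , 0# , 0# ⟩
  basis (suc (suc zero)) = ⟨ 0# , 0# , 1# , 0# ⟩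
  basis (suc (suc (suc zero))) = ⟨ 0# , 0# , 0# , 1# ⟩

open ℍ-Operations ℤ.+-*-rawRing

private
  PolynomialRawRing : ℕ → RawRing 0ℓ 0ℓ
  PolynomialRawRing n = record
    { Carrier = Expr ℤ n ; _≈_ = _≡_
    ; _+_ = _⊕_ ; _*_ = _⊗_ ; -_ = ⊝_ ; 0# = Κ 0ℤ ; 1# = Κ 1ℤ }

  module Poly {n} = ℍ-Operations (PolynomialRawRing n)

  ⟦_⟧ℍ : ∀ {n} → ℍ (Expr ℤ n) → Vec ℤ n → ℍ ℤ
  ⟦ ⟨ p₀ , p₁ , p₂ , p₃ ⟩ ⟧ℍ ρ = ⟨ ⟦ p₀ ⟧ ρ , ⟦ p₁ ⟧ ρ , ⟦ p₂ ⟧ ρ , ⟦ p₃ ⟧ ρ ⟩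

  prove-ℍ : ∀ {n} (ρ : Vec ℤ n) (p q : ℍ (Expr ℤ n)) →
    ⟦ ℍ.re p ⇓⟧ ρ ≡ ⟦ ℍ.re q ⇓⟧ ρ → ⟦ ℍ.imᵢ p ⇓⟧ ρ ≡ ⟦ ℍ.imᵢ q ⇓⟧ ρ →
    ⟦ ℍ.imⱼ p ⇓⟧ ρ ≡ ⟦ ℍ.imⱼ q ⇓⟧ ρ → ⟦ ℍ.imₖ p ⇓⟧ ρ ≡ ⟦ ℍ.imₖ q ⇓⟧ ρ →
    ⟦ p ⟧ℍ ρ ≡ ⟦ q ⟧ℍ ρ
  prove-ℍ ρ ⟨ p₀ , p₁ , p₂ , p₃ ⟩ ⟨ q₀ , q₁ , q₂ , q₃ ⟩ e₀ e₁ e₂ e₃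
    rewrite prove ρ p₀ q₀ e₀ | prove ρ p₁ q₁ e₁ | prove ρ p₂ q₂ e₂ | prove ρ p₃ q₃ e₃ = refl

  coordinates : ∀ {m} → Vec (ℍ ℤ) m → Vec ℤ (m ℕ.* 4)
  coordinates xs = concat (Vec.map (λ x → ℍ.re x ∷ ℍ.imᵢ x ∷ ℍ.imⱼ x ∷ ℍ.imₖ x ∷ []) xs)

  -- The variable indices must be literals: computing them (say with Fin.combine) makes the
  -- solver's normalisation far too slow.
  X₀ : ∀ {n} → ℍ (Expr ℤ (4 ℕ.+ n))
  X₀ = ⟨ Ι (# 0) , Ι (# 1) , Ι (# 2) , Ι (# 3) ⟩

  X₁ : ∀ {n} → ℍ (Expr ℤ (8 ℕ.+ n))
  X₁ = ⟨ Ι (# 4) , Ι (# 5) , Ι (# 6) , Ι (# 7) ⟩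

  X₂ : ∀ {n} → ℍ (Expr ℤ (12 ℕ.+ n))
  X₂ = ⟨ Ι (# 8) , Ι (# 9) , Ι (# 10) , Ι (# 11) ⟩

·-assoc : ∀ x y z → (x · y) · z ≡ x · (y · z)
·-assoc x y z = prove-ℍ (coordinates (x ∷ y ∷ z ∷ []))
  ((X₀ Poly.· X₁) Poly.· X₂) (X₀ Poly.· (X₁ Poly.· X₂)) refl refl refl refl

·-conj : ∀ x → x · conj x ≡ scalar (norm x)
·-conj x = prove-ℍ (coordinates (x ∷ []))
  (X₀ Poly.· Poly.conj X₀) (Poly.scalar (Poly.norm X₀)) refl refl refl refl

·-scalar : ∀ a x → x · scalar a ≡ a ⋆ x
·-scalar a x = prove-ℍ (coordinates (x ∷ scalar a ∷ []))
  (X₀ Poly.· Poly.scalar (ℍ.re X₁)) (ℍ.re X₁ Poly.⋆ X₀) refl refl refl refl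

⋆-· : ∀ a x y → (a ⋆ x) · y ≡ a ⋆ (x · y)
⋆-· a x y = prove-ℍ (coordinates (x ∷ y ∷ scalar a ∷ []))
  ((ℍ.re X₂ Poly.⋆ X₀) Poly.· X₁) (ℍ.re X₂ Poly.⋆ (X₀ Poly.· X₁)) refl refl refl refl

·-⋆ : ∀ a x y → x · (a ⋆ y) ≡ a ⋆ (x · y)
·-⋆ a x y = prove-ℍ (coordinates (x ∷ y ∷ scalar a ∷ []))
  (X₀ Poly.· (ℍ.re X₂ Poly.⋆ X₁)) (ℍ.re X₂ Poly.⋆ (X₀ Poly.· X₁)) refl refl refl refl

norm-· : ∀ x y → norm (x · y) ≡ norm x ℤ.* norm y
norm-· x y = prove (coordinates (x ∷ y ∷ []))
  (Poly.norm (X₀ Poly.· X₁)) (Poly.norm X₀ ⊗ Poly.norm X₁) refl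

dot-·ˡ : ∀ a x y → dot (a · x) (a · y) ≡ norm a ℤ.* dot x y
dot-·ˡ a x y = prove (coordinates (a ∷ x ∷ y ∷ []))
  (Poly.dot (X₀ Poly.· X₁) (X₀ Poly.· X₂)) (Poly.norm X₀ ⊗ Poly.dot X₁ X₂) refl

private
  basis-expansion : Fin 4 → Expr ℤ 8
  basis-expansion c = Poly.Σ₄ λ j → coord (X₀ Poly.· Poly.basis j) c ⊗ coord X₁ j

·-basis-expansion : ∀ a x c → Σ₄ (λ j → coord (a · basis j) c ℤ.* coord x j) ≡ coord (a · x) c
·-basis-expansion a x zero =
  prove (coordinates (a ∷ x ∷ [])) (basis-expansion i0) (coord (X₀ Poly.· X₁) i0) refl
·-basis-expansion a x (suc zero) =
  prove (coordinates (a ∷ x ∷ [])) (basis-expansion i1) (coord (X₀ Poly.· X₁) i1) refl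
·-basis-expansion a x (suc (suc zero)) =
  prove (coordinates (a ∷ x ∷ [])) (basis-expansion i2) (coord (X₀ Poly.· X₁) i2) refl
·-basis-expansion a x (suc (suc (suc zero))) =
  prove (coordinates (a ∷ x ∷ [])) (basis-expansion i3) (coord (X₀ Poly.· X₁) i3) refl

⋆-cancel : ∀ k .{{_ : ℤ.NonZero k}} {x y} → k ⋆ x ≡ k ⋆ y → x ≡ y
⋆-cancel k kx≡ky = coord-injective λ where
    zero → cancel (cong ℍ.re kx≡ky)
    (suc zero) → cancel (cong ℍ.imᵢ kx≡ky)
    (suc (suc zero)) → cancel (cong ℍ.imⱼ kx≡ky)
    (suc (suc (suc zero))) → cancel (cong ℍ.imₖ kx≡ky)
  where
  cancel : ∀ {u v} → k ℤ.* u ≡ k ℤ.* v → u ≡ v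
  cancel = ℤ.*-cancelˡ-≡ k _ _

basis-normalised : ∀ i → dot (basis i) (basis i) ≡ 1ℤ
basis-normalised zero = refl
basis-normalised (suc zero) = refl
basis-normalised (suc (suc zero)) = refl
basis-normalised (suc (suc (suc zero))) = refl

basis-orthogonal : ∀ {i j} → i ≢ j → dot (basis i) (basis j) ≡ 0ℤ
basis-orthogonal {zero} {zero} i≢j = contradiction refl i≢j
basis-orthogonal {suc zero} {suc zero} i≢j = contradiction refl i≢j
basis-orthogonal {suc (suc zero)} {suc (suc zero)} i≢j = contradiction refl i≢j
basis-orthogonal {suc (suc (suc zero))} {suc (suc (suc zero))} i≢j = contradiction refl i≢j
basis-orthogonal {zero} {suc zero} _ = refl
basis-orthogonal {zero} {suc (suc zero)} _ = refl
basis-orthogonal {zero} {suc (suc (suc zero))} _ = refl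
basis-orthogonal {suc zero} {zero} _ = refl
basis-orthogonal {suc zero} {suc (suc zero)} _ = refl
basis-orthogonal {suc zero} {suc (suc (suc zero))} _ = refl
basis-orthogonal {suc (suc zero)} {zero} _ = refl
basis-orthogonal {suc (suc zero)} {suc zero} _ = refl
basis-orthogonal {suc (suc zero)} {suc (suc (suc zero))} _ = refl
basis-orthogonal {suc (suc (suc zero))} {zero} _ = refl
basis-orthogonal {suc (suc (suc zero))} {suc zero} _ = refl
basis-orthogonal {suc (suc (suc zero))} {suc (suc zero)} _ = refl

1+i 1+j 1+k : ℍ ℤ
1+i = ⟨ 1ℤ , 1ℤ , 0ℤ , 0ℤ ⟩
1+j = ⟨ 1ℤ , 0ℤ , 1ℤ , 0ℤ ⟩
1+k = ⟨ 1ℤ , 0ℤ , 0ℤ , 1ℤ ⟩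

private
  S T U V : ∀ {n} → Expr ℤ (4 ℕ.+ n)
  S = Ι (# 0)
  T = Ι (# 1)
  U = Ι (# 2)
  V = Ι (# 3)

  infixl 6 _⊖_
  _⊖_ : ∀ {n} → Expr ℤ n → Expr ℤ n → Expr ℤ n
  p ⊖ q = p ⊕ ⊝ q

  twice : ∀ {n} → Expr ℤ n → Expr ℤ n
  twice p = p ⊗ Κ (+ 2)

·1+i : ∀ s t y₀ y₃ →
  ⟨ s , s ℤ.- y₀ , t ℤ.- y₃ , t ⟩ · 1+i ≡ ⟨ y₀ , s ℤ.* + 2 ℤ.- y₀ , t ℤ.* + 2 ℤ.- y₃ , y₃ ⟩
·1+i s t y₀ y₃ = prove-ℍ (s ∷ t ∷ y₀ ∷ y₃ ∷ [])
  (⟨ S , S ⊖ U , T ⊖ V , T ⟩ Poly.· ⟨ Κ 1ℤ , Κ 1ℤ , Κ 0ℤ , Κ 0ℤ ⟩)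
  ⟨ U , twice S ⊖ U , twice T ⊖ V , V ⟩ refl refl refl refl

·1+j : ∀ s t y₀ y₁ →
  ⟨ s , t , s ℤ.- y₀ , t ℤ.- y₁ ⟩ · 1+j ≡ ⟨ y₀ , y₁ , s ℤ.* + 2 ℤ.- y₀ , t ℤ.* + 2 ℤ.- y₁ ⟩
·1+j s t y₀ y₁ = prove-ℍ (s ∷ t ∷ y₀ ∷ y₁ ∷ [])
  (⟨ S , T , S ⊖ U , T ⊖ V ⟩ Poly.· ⟨ Κ 1ℤ , Κ 0ℤ , Κ 1ℤ , Κ 0ℤ ⟩)
  ⟨ U , V , twice S ⊖ U , twice T ⊖ V ⟩ refl refl refl refl

·1+k : ∀ s t y₀ y₂ →
  ⟨ s , t ℤ.- y₂ , t , s ℤ.- y₀ ⟩ · 1+k ≡ ⟨ y₀ , t ℤ.* + 2 ℤ.- y₂ , y₂ , s ℤ.* + 2 ℤ.- y₀ ⟩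
·1+k s t y₀ y₂ = prove-ℍ (s ∷ t ∷ y₀ ∷ y₂ ∷ [])
  (⟨ S , T ⊖ V , T , S ⊖ U ⟩ Poly.· ⟨ Κ 1ℤ , Κ 0ℤ , Κ 0ℤ , Κ 1ℤ ⟩)
  ⟨ U , twice T ⊖ V , V , twice S ⊖ U ⟩ refl refl refl refl

even⊎odd : ∀ z → + 2 ∣ z ⊎ + 2 ∣ z ℤ.+ 1ℤ
even⊎odd z with z ℤ.% + 2 | ℤ.n%d<d z (+ 2) | ℤ.a≡a%n+[a/n]*n z (+ 2)
... | 0 | _ | z≡0+q*2 = inj₁ (divides (z ℤ./ + 2) (trans z≡0+q*2 (ℤ.+-identityˡ _)))
... | 1 | _ | z≡1+q*2 =
  inj₂ (divides (z ℤ./ + 2 ℤ.+ 1ℤ) (trans (cong (ℤ._+ 1ℤ) z≡1+q*2) (regroup (z ℤ./ + 2))))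
  where
  regroup : ∀ q → + 1 ℤ.+ q ℤ.* + 2 ℤ.+ 1ℤ ≡ (q ℤ.+ 1ℤ) ℤ.* + 2
  regroup = solve-∀
... | ℕ.suc (ℕ.suc _) | ℕ.s≤s (ℕ.s≤s ()) | _

2∣z*z-z : ∀ z → + 2 ∣ z ℤ.* z ℤ.- z
2∣z*z-z z = subst (+ 2 ∣_) (expand z) (2∣z[z-1] (even⊎odd z))
  where
  expand : ∀ z → z ℤ.* (z ℤ.- 1ℤ) ≡ z ℤ.* z ℤ.- z
  expand = solve-∀
  shift : ∀ z → z ℤ.+ 1ℤ ℤ.- + 2 ≡ z ℤ.- 1ℤ
  shift = solve-∀
  2∣z[z-1] : + 2 ∣ z ⊎ + 2 ∣ z ℤ.+ 1ℤ → + 2 ∣ z ℤ.* (z ℤ.- 1ℤ)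
  2∣z[z-1] (inj₁ 2∣z) = ∣m⇒∣m*n (z ℤ.- 1ℤ) 2∣z
  2∣z[z-1] (inj₂ 2∣z+1) = ∣n⇒∣m*n z (subst (+ 2 ∣_) (shift z) (∣m∣n⇒∣m-n 2∣z+1 ∣-refl))

2∣norm-sum : ∀ x → + 2 ∣ norm x ℤ.- sum4ℤ (coord x)
2∣norm-sum ⟨ x₀ , x₁ , x₂ , x₃ ⟩ = subst (+ 2 ∣_) (regroup x₀ x₁ x₂ x₃)
  (∣m∣n⇒∣m+n (∣m∣n⇒∣m+n (∣m∣n⇒∣m+n (2∣z*z-z x₀) (2∣z*z-z x₁)) (2∣z*z-z x₂)) (2∣z*z-z x₃))
  where
  regroup : ∀ a b c d → (a ℤ.* a ℤ.- a) ℤ.+ (b ℤ.* b ℤ.- b) ℤ.+ (c ℤ.* c ℤ.- c) ℤ.+ (d ℤ.* d ℤ.- d)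
    ≡ (a ℤ.* a ℤ.+ b ℤ.* b ℤ.+ c ℤ.* c ℤ.+ d ℤ.* d) ℤ.- (a ℤ.+ b ℤ.+ c ℤ.+ d)
  regroup = solve-∀

even-norm⇒InD4 : ∀ x → + 2 ∣ norm x → InD4 (coord x)
even-norm⇒InD4 x 2∣norm = ∣⇒∣ᵤ (subst (+ 2 ∣_) (cancel (norm x) (sum4ℤ (coord x)))
  (∣m∣n⇒∣m-n 2∣norm (2∣norm-sum x)))
  where
  cancel : ∀ n s → n ℤ.- (n ℤ.- s) ≡ s
  cancel = solve-∀

EvenPairing : ℤ → ℤ → ℤ → ℤ → Set
EvenPairing y₀ y₁ y₂ y₃ =
    (+ 2 ∣ y₀ ℤ.+ y₁ × + 2 ∣ y₂ ℤ.+ y₃)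
  ⊎ (+ 2 ∣ y₀ ℤ.+ y₂ × + 2 ∣ y₁ ℤ.+ y₃)
  ⊎ (+ 2 ∣ y₀ ℤ.+ y₃ × + 2 ∣ y₁ ℤ.+ y₂)

even-pairing : ∀ y₀ y₁ y₂ y₃ → + 2 ∣ y₀ ℤ.+ y₁ ℤ.+ y₂ ℤ.+ y₃ → EvenPairing y₀ y₁ y₂ y₃
even-pairing y₀ y₁ y₂ y₃ 2∣Σ = by-parity (even⊎odd (y₀ ℤ.+ y₁)) (even⊎odd (y₀ ℤ.+ y₂))
  where
  ys = y₀ ∷ y₁ ∷ y₂ ∷ y₃ ∷ []

  complement : ∀ {a b} → + 2 ∣ a → a ℤ.+ b ≡ y₀ ℤ.+ y₁ ℤ.+ y₂ ℤ.+ y₃ → + 2 ∣ b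
  complement 2∣a a+b≡Σ = ∣m+n∣m⇒∣n (subst (+ 2 ∣_) (sym a+b≡Σ) 2∣Σ) 2∣a

  odd+odd : + 2 ∣ y₀ ℤ.+ y₁ ℤ.+ 1ℤ → + 2 ∣ y₀ ℤ.+ y₂ ℤ.+ 1ℤ → + 2 ∣ y₁ ℤ.+ y₂
  odd+odd 2∣y₀₁+1 2∣y₀₂+1 = subst (+ 2 ∣_) regroup
    (∣m∣n⇒∣m-n (∣m∣n⇒∣m+n 2∣y₀₁+1 2∣y₀₂+1) (∣n⇒∣m*n (y₀ ℤ.+ 1ℤ) ∣-refl))
    where
    regroup : y₀ ℤ.+ y₁ ℤ.+ 1ℤ ℤ.+ (y₀ ℤ.+ y₂ ℤ.+ 1ℤ) ℤ.- (y₀ ℤ.+ 1ℤ) ℤ.* + 2 ≡ y₁ ℤ.+ y₂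
    regroup = solve ys

  by-parity : + 2 ∣ y₀ ℤ.+ y₁ ⊎ + 2 ∣ y₀ ℤ.+ y₁ ℤ.+ 1ℤ → + 2 ∣ y₀ ℤ.+ y₂ ⊎ + 2 ∣ y₀ ℤ.+ y₂ ℤ.+ 1ℤ →
    EvenPairing y₀ y₁ y₂ y₃
  by-parity (inj₁ 2∣y₀₁) _ = inj₁ (2∣y₀₁ , complement 2∣y₀₁ (solve ys))
  by-parity (inj₂ _) (inj₁ 2∣y₀₂) = inj₂ (inj₁ (2∣y₀₂ , complement 2∣y₀₂ (solve ys)))
  by-parity (inj₂ 2∣y₀₁+1) (inj₂ 2∣y₀₂+1) = inj₂ (inj₂ (complement 2∣y₁₂ (solve ys) , 2∣y₁₂))
    where 2∣y₁₂ = odd+odd 2∣y₀₁+1 2∣y₀₂+1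

interval : ℕ → List ℤ
interval N = map +_ (upTo (ℕ.suc N)) ++ map -[1+_] (upTo N)

∈-interval : ∀ {N} z → ℤ.∣ z ∣ ≤ N → z ∈ interval N
∈-interval (+ n) n≤N = ∈-++⁺ˡ (∈-map⁺ +_ (∈-upTo⁺ (ℕ.s≤s n≤N)))
∈-interval -[1+ n ] 1+n≤N = ∈-++⁺ʳ _ (∈-map⁺ -[1+_] (∈-upTo⁺ 1+n≤N))

box : ℕ → List (ℍ ℤ)
box N = cartesianProductWith (λ (x₀ , x₁) (x₂ , x₃) → ⟨ x₀ , x₁ , x₂ , x₃ ⟩) pairs pairs
  where pairs = cartesianProduct (interval N) (interval N)

∈-box : ∀ {N} x → (∀ c → ℤ.∣ coord x c ∣ ≤ N) → x ∈ box N
∈-box x bounded = ∈-cartesianProductWith⁺ _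
  (∈-cartesianProductWith⁺ _,_ (∈-interval _ (bounded i0)) (∈-interval _ (bounded i1)))
  (∈-cartesianProductWith⁺ _,_ (∈-interval _ (bounded i2)) (∈-interval _ (bounded i3)))

∣_∣² : ℤ → ℕ
∣ z ∣² = ℤ.∣ z ∣ ℕ.* ℤ.∣ z ∣

square≡∣∣² : ∀ z → z ℤ.* z ≡ + ∣ z ∣²
square≡∣∣² (+ n) = sym (ℤ.pos-* n n)
square≡∣∣² -[1+ n ] = refl

∣∣≤∣∣² : ∀ z → ℤ.∣ z ∣ ≤ ∣ z ∣²
∣∣≤∣∣² (+ 0) = ℕ.z≤n
∣∣≤∣∣² (+ ℕ.suc n) = ℕ.m≤m*n (ℕ.suc n) (ℕ.suc n)
∣∣≤∣∣² -[1+ n ] = ℕ.m≤m*n (ℕ.suc n) (ℕ.suc n)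

norm≡Σ∣∣² : ∀ x → norm x ≡ + (∣ ℍ.re x ∣² ℕ.+ ∣ ℍ.imᵢ x ∣² ℕ.+ ∣ ℍ.imⱼ x ∣² ℕ.+ ∣ ℍ.imₖ x ∣²)
norm≡Σ∣∣² ⟨ x₀ , x₁ , x₂ , x₃ ⟩ = trans
  (cong₂ ℤ._+_ (cong₂ ℤ._+_ (cong₂ ℤ._+_ (square≡∣∣² x₀) (square≡∣∣² x₁)) (square≡∣∣² x₂))
    (square≡∣∣² x₃))
  (sym (trans (ℤ.pos-+ (s₀ ℕ.+ s₁ ℕ.+ s₂) s₃)
    (cong (ℤ._+ + s₃) (trans (ℤ.pos-+ (s₀ ℕ.+ s₁) s₂) (cong (ℤ._+ + s₂) (ℤ.pos-+ s₀ s₁))))))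
  where s₀ = ∣ x₀ ∣²; s₁ = ∣ x₁ ∣²; s₂ = ∣ x₂ ∣²; s₃ = ∣ x₃ ∣²

∣coord∣≤norm : ∀ {n} x → norm x ≡ + n → ∀ c → ℤ.∣ coord x c ∣ ≤ n
∣coord∣≤norm {n} x@(⟨ x₀ , x₁ , x₂ , x₃ ⟩) norm≡n c =
  ℕ.≤-trans (∣∣≤∣∣² (coord x c)) (subst (∣ coord x c ∣² ≤_) Σ≡n (summand c))
  where
  s₀ = ∣ x₀ ∣²; s₁ = ∣ x₁ ∣²; s₂ = ∣ x₂ ∣²; s₃ = ∣ x₃ ∣²
  Σ≡n : s₀ ℕ.+ s₁ ℕ.+ s₂ ℕ.+ s₃ ≡ n
  Σ≡n = ℤ.+-injective (trans (sym (norm≡Σ∣∣² x)) norm≡n)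
  summand : ∀ c → ∣ coord x c ∣² ≤ s₀ ℕ.+ s₁ ℕ.+ s₂ ℕ.+ s₃
  summand zero = ℕ.≤-trans (ℕ.m≤m+n s₀ s₁) (ℕ.≤-trans (ℕ.m≤m+n _ s₂) (ℕ.m≤m+n _ s₃))
  summand (suc zero) = ℕ.≤-trans (ℕ.m≤n+m s₁ s₀) (ℕ.≤-trans (ℕ.m≤m+n _ s₂) (ℕ.m≤m+n _ s₃))
  summand (suc (suc zero)) = ℕ.≤-trans (ℕ.m≤n+m s₂ (s₀ ℕ.+ s₁)) (ℕ.m≤m+n _ s₃)
  summand (suc (suc (suc zero))) = ℕ.m≤n+m s₃ (s₀ ℕ.+ s₁ ℕ.+ s₂)

open import Data.List.Membership.DecPropositional _≟ℍ_ using (_∈?_)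

roots : List (ℍ ℤ)
roots =
  ⟨ 1ℤ , 1ℤ , 0ℤ , 0ℤ ⟩ ∷ ⟨ 1ℤ , -1ℤ , 0ℤ , 0ℤ ⟩ ∷ ⟨ -1ℤ , 1ℤ , 0ℤ , 0ℤ ⟩ ∷ ⟨ -1ℤ , -1ℤ , 0ℤ , 0ℤ ⟩ ∷
  ⟨ 1ℤ , 0ℤ , 1ℤ , 0ℤ ⟩ ∷ ⟨ 1ℤ , 0ℤ , -1ℤ , 0ℤ ⟩ ∷ ⟨ -1ℤ , 0ℤ , 1ℤ , 0ℤ ⟩ ∷ ⟨ -1ℤ , 0ℤ , -1ℤ , 0ℤ ⟩ ∷
  ⟨ 1ℤ , 0ℤ , 0ℤ , 1ℤ ⟩ ∷ ⟨ 1ℤ , 0ℤ , 0ℤ , -1ℤ ⟩ ∷ ⟨ -1ℤ , 0ℤ , 0ℤ , 1ℤ ⟩ ∷ ⟨ -1ℤ , 0ℤ , 0ℤ , -1ℤ ⟩ ∷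
  ⟨ 0ℤ , 1ℤ , 1ℤ , 0ℤ ⟩ ∷ ⟨ 0ℤ , 1ℤ , -1ℤ , 0ℤ ⟩ ∷ ⟨ 0ℤ , -1ℤ , 1ℤ , 0ℤ ⟩ ∷ ⟨ 0ℤ , -1ℤ , -1ℤ , 0ℤ ⟩ ∷
  ⟨ 0ℤ , 1ℤ , 0ℤ , 1ℤ ⟩ ∷ ⟨ 0ℤ , 1ℤ , 0ℤ , -1ℤ ⟩ ∷ ⟨ 0ℤ , -1ℤ , 0ℤ , 1ℤ ⟩ ∷ ⟨ 0ℤ , -1ℤ , 0ℤ , -1ℤ ⟩ ∷
  ⟨ 0ℤ , 0ℤ , 1ℤ , 1ℤ ⟩ ∷ ⟨ 0ℤ , 0ℤ , 1ℤ , -1ℤ ⟩ ∷ ⟨ 0ℤ , 0ℤ , -1ℤ , 1ℤ ⟩ ∷ ⟨ 0ℤ , 0ℤ , -1ℤ , -1ℤ ⟩ ∷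
  []

roots-norm : All (λ x → norm x ≡ + 2) roots
roots-norm = toWitness {a? = All.all? (λ x → norm x ℤ.≟ + 2) roots} tt

roots-complete : All (λ x → norm x ≡ + 2 → x ∈ roots) (box 2)
roots-complete = toWitness {a? = All.all? (λ x → (norm x ℤ.≟ + 2) →-dec (x ∈? roots)) (box 2)} tt

norm≡2⇒∈roots : ∀ x → norm x ≡ + 2 → x ∈ roots
norm≡2⇒∈roots x norm≡2 = All.lookup roots-complete (∈-box x (∣coord∣≤norm x norm≡2)) norm≡2

pairing-roots : List (ℍ ℤ)
pairing-roots = 1+i ∷ 1+j ∷ 1+k ∷ []

pairing-roots-norm : All (λ r → norm r ≡ + 2) pairing-roots
pairing-roots-norm = refl ∷ refl ∷ refl ∷ []

-- That is, x · x̄′ · r / 2 is again a root. The check is restricted to the three r that occur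
-- in factorisations; checking all 24 roots r is needlessly slow.
roots-triple-product : All (λ x → All (λ x′ → All (λ r →
  Any (λ w → + 2 ⋆ w ≡ (x · conj x′) · r) roots) pairing-roots) roots) roots
roots-triple-product = toWitness {a? = All.all? (λ x → All.all? (λ x′ → All.all? (λ r →
  Any.any? (λ w → + 2 ⋆ w ≟ℍ (x · conj x′) · r) roots) pairing-roots) roots) roots} tt

open import Data.Nat using (_*_)

+[2*m]≡+m*2 : ∀ m → + (2 * m) ≡ + m ℤ.* + 2
+[2*m]≡+m*2 m = trans (cong +_ (ℕ.*-comm 2 m)) (ℤ.pos-* m 2)

norm⇒InD4Shell : ∀ {m} y → norm y ≡ + (2 * m) → InD4Shell (2 * m) (coord y)
norm⇒InD4Shell {m} y norm≡2m =
  even-norm⇒InD4 y (divides (+ m) (trans norm≡2m (+[2*m]≡+m*2 m))) , norm≡2m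

-- Quaternion arguments are made explicit because Agda cannot infer them through _·_ or norm,
-- which reduce to integer arithmetic.
norm-cofactor : ∀ {m y} a r → norm r ≡ + 2 → a · r ≡ y → norm y ≡ + (2 * m) → norm a ≡ + m
norm-cofactor {m} {y} a r norm-r a·r≡y norm-y = ℤ.*-cancelʳ-≡ (norm a) (+ m) (+ 2) (begin
  norm a ℤ.* + 2     ≡⟨ cong (norm a ℤ.*_) norm-r ⟨
  norm a ℤ.* norm r  ≡⟨ norm-· a r ⟨
  norm (a · r)       ≡⟨ cong norm a·r≡y ⟩
  norm y             ≡⟨ norm-y ⟩
  + (2 * m)          ≡⟨ +[2*m]≡+m*2 m ⟩
  + m ℤ.* + 2        ∎)
  where open ≡-Reasoning

norm-image : ∀ {m} a x → norm a ≡ + m → norm x ≡ + 2 → norm (a · x) ≡ + (2 * m)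
norm-image {m} a x norm-a norm-x =
  trans (norm-· a x) (trans (cong₂ ℤ._*_ norm-a norm-x) (sym (+[2*m]≡+m*2 m)))

record Factorisation (m : ℕ) (y : ℍ ℤ) : Set where
  field
    factor root : ℍ ℤ
    root∈pairing-roots : root ∈ pairing-roots
    norm-factor : norm factor ≡ + m
    factor·root : factor · root ≡ y

factorisation : ∀ {m y} a r → r ∈ pairing-roots → a · r ≡ y → norm y ≡ + (2 * m) →
  Factorisation m y
factorisation a r r∈pairing-roots a·r≡y norm-y = record
  { factor = a
  ; root = r
  ; root∈pairing-roots = r∈pairing-roots
  ; norm-factor = norm-cofactor a r (All.lookup pairing-roots-norm r∈pairing-roots) a·r≡y norm-y
  ; factor·root = a·r≡y
  }

private
  m+n≡k⇒n≡k-m : ∀ {m n k} → m ℤ.+ n ≡ k → n ≡ k ℤ.- m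
  m+n≡k⇒n≡k-m {m} {n} refl = cancel m n
    where
    cancel : ∀ m n → n ≡ m ℤ.+ n ℤ.- m
    cancel = solve-∀

  m+n≡k⇒m≡k-n : ∀ {m n k} → m ℤ.+ n ≡ k → m ≡ k ℤ.- n
  m+n≡k⇒m≡k-n {m} {n} refl = cancel m n
    where
    cancel : ∀ m n → m ≡ m ℤ.+ n ℤ.- n
    cancel = solve-∀

factor-through-pairing : ∀ {m} y₀ y₁ y₂ y₃ → norm ⟨ y₀ , y₁ , y₂ , y₃ ⟩ ≡ + (2 * m) →
  EvenPairing y₀ y₁ y₂ y₃ → Factorisation m ⟨ y₀ , y₁ , y₂ , y₃ ⟩
factor-through-pairing y₀ y₁ y₂ y₃ norm-y (inj₁ (divides s y₀+y₁≡2s , divides t y₂+y₃≡2t)) =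
  factorisation ⟨ s , s ℤ.- y₀ , t ℤ.- y₃ , t ⟩ 1+i (here refl)
    (trans (·1+i s t y₀ y₃) (cong₂ (λ u v → ⟨ y₀ , u , v , y₃ ⟩)
      (sym (m+n≡k⇒n≡k-m y₀+y₁≡2s)) (sym (m+n≡k⇒m≡k-n y₂+y₃≡2t)))) norm-y
factor-through-pairing y₀ y₁ y₂ y₃ norm-y (inj₂ (inj₁ (divides s y₀+y₂≡2s , divides t y₁+y₃≡2t))) =
  factorisation ⟨ s , t , s ℤ.- y₀ , t ℤ.- y₁ ⟩ 1+j (there (here refl))
    (trans (·1+j s t y₀ y₁) (cong₂ (λ u v → ⟨ y₀ , y₁ , u , v ⟩)
      (sym (m+n≡k⇒n≡k-m y₀+y₂≡2s)) (sym (m+n≡k⇒n≡k-m y₁+y₃≡2t)))) norm-y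
factor-through-pairing y₀ y₁ y₂ y₃ norm-y (inj₂ (inj₂ (divides s y₀+y₃≡2s , divides t y₁+y₂≡2t))) =
  factorisation ⟨ s , t ℤ.- y₂ , t , s ℤ.- y₀ ⟩ 1+k (there (there (here refl)))
    (trans (·1+k s t y₀ y₂) (cong₂ (λ u v → ⟨ y₀ , u , y₂ , v ⟩)
      (sym (m+n≡k⇒m≡k-n y₁+y₂≡2t)) (sym (m+n≡k⇒n≡k-m y₀+y₃≡2s)))) norm-y

factorise : ∀ {m} y → norm y ≡ + (2 * m) → Factorisation m y
factorise {m} y@(⟨ y₀ , y₁ , y₂ , y₃ ⟩) norm-y = factor-through-pairing y₀ y₁ y₂ y₃ norm-y
  (even-pairing y₀ y₁ y₂ y₃ (∣ᵤ⇒∣ (proj₁ (norm⇒InD4Shell {m} y norm-y))))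

infix 4 _·roots∋_
_·roots∋_ : ℍ ℤ → ℍ ℤ → Set
a ·roots∋ y = Any (λ x → a · x ≡ y) roots

overlapping-orbits : ∀ a b {x x′ r} → x ∈ roots → x′ ∈ roots → r ∈ pairing-roots →
  b · x ≡ a · x′ → b ·roots∋ a · r
overlapping-orbits a b {x} {x′} {r} x∈roots x′∈roots r∈pairing-roots b·x≡a·x′ = Any.map b·w≡a·r
  (All.lookup (All.lookup (All.lookup roots-triple-product x∈roots) x′∈roots) r∈pairing-roots)
  where
  open ≡-Reasoning
  b·w≡a·r : ∀ {w} → + 2 ⋆ w ≡ (x · conj x′) · r → b · w ≡ a · r
  b·w≡a·r {w} 2w≡xx̄′r = ⋆-cancel (+ 2) (begin
    + 2 ⋆ (b · w)              ≡⟨ ·-⋆ (+ 2) b w ⟨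
    b · (+ 2 ⋆ w)              ≡⟨ cong (b ·_) 2w≡xx̄′r ⟩
    b · ((x · conj x′) · r)    ≡⟨ ·-assoc b (x · conj x′) r ⟨
    (b · (x · conj x′)) · r    ≡⟨ cong (_· r) (·-assoc b x (conj x′)) ⟨
    ((b · x) · conj x′) · r    ≡⟨ cong (λ z → (z · conj x′) · r) b·x≡a·x′ ⟩
    ((a · x′) · conj x′) · r   ≡⟨ cong (_· r) (·-assoc a x′ (conj x′)) ⟩
    (a · (x′ · conj x′)) · r   ≡⟨ cong (λ z → (a · z) · r) (·-conj x′) ⟩
    (a · scalar (norm x′)) · r ≡⟨ cong (λ n → (a · scalar n) · r) (All.lookup roots-norm x′∈roots) ⟩
    (a · scalar (+ 2)) · r     ≡⟨ cong (_· r) (·-scalar (+ 2) a) ⟩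
    (+ 2 ⋆ a) · r              ≡⟨ ⋆-· (+ 2) a r ⟩
    + 2 ⋆ (a · r)              ∎)

DisjointOrbits : ℍ ℤ → ℍ ℤ → Set
DisjointOrbits a b = ∀ x x′ → x ∈ roots → x′ ∈ roots → a · x ≢ b · x′

DisjointOrbits-sym : Symmetric DisjointOrbits
DisjointOrbits-sym disjoint x x′ x∈roots x′∈roots b·x≡a·x′ =
  disjoint x′ x x′∈roots x∈roots (sym b·x≡a·x′)

uncovered⇒disjoint : ∀ {m y} b (F : Factorisation m y) → ¬ (b ·roots∋ y) →
  DisjointOrbits (Factorisation.factor F) b
uncovered⇒disjoint b F ¬b∋y _ _ x∈roots x′∈roots a·x≡b·x′ = ¬b∋y (subst (b ·roots∋_) factor·root
  (overlapping-orbits factor b x′∈roots x∈roots root∈pairing-roots (sym a·x≡b·x′)))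
  where open Factorisation F

AllPairs-lookup : ∀ {A : Set} {R : A → A → Set} {xs} → Symmetric R → AllPairs R xs →
  ∀ {i j} → i ≢ j → R (List.lookup xs i) (List.lookup xs j)
AllPairs-lookup R-sym (_ ∷ _) {zero} {zero} i≢j = contradiction refl i≢j
AllPairs-lookup R-sym (Rx ∷ _) {zero} {suc j} _ = All.lookup Rx (∈-lookup j)
AllPairs-lookup R-sym (Rx ∷ _) {suc i} {zero} _ = R-sym (All.lookup Rx (∈-lookup i))
AllPairs-lookup R-sym (_ ∷ pairs) {suc i} {suc j} i≢j = AllPairs-lookup R-sym pairs (i≢j ∘ cong suc)

module Selection (m : ℕ) where

  Covered : List (ℍ ℤ) → ℍ ℤ → Set
  Covered as y = Any (_·roots∋ y) as

  covered? : ∀ as y → Dec (Covered as y)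
  covered? as y = Any.any? (λ a → Any.any? (λ x → a · x ≟ℍ y) roots) as

  Admissible : List (ℍ ℤ) → Set
  Admissible as = All (λ a → norm a ≡ + m) as × AllPairs DisjointOrbits as

  extend : ℍ ℤ → List (ℍ ℤ) → List (ℍ ℤ)
  extend y as with norm y ℤ.≟ + (2 * m)
  ... | no _ = as
  ... | yes norm-y with covered? as y
  ...   | yes _ = as
  ...   | no _ = Factorisation.factor (factorise {m} y norm-y) ∷ as

  extend-admissible : ∀ y {as} → Admissible as → Admissible (extend y as)
  extend-admissible y {as} admissible with norm y ℤ.≟ + (2 * m)
  ... | no _ = admissible
  ... | yes norm-y with covered? as y
  ...   | yes _ = admissible
  ...   | no ¬covered = (Factorisation.norm-factor F ∷ proj₁ admissible)
                      , (All.tabulate disjoint ∷ proj₂ admissible)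
    where
    F = factorise {m} y norm-y
    disjoint : ∀ {b} → b ∈ as → DisjointOrbits (Factorisation.factor F) b
    disjoint {b} b∈as = uncovered⇒disjoint b F (¬covered ∘ lose b∈as)

  extend-monotone : ∀ y {as z} → Covered as z → Covered (extend y as) z
  extend-monotone y {as} covered with norm y ℤ.≟ + (2 * m)
  ... | no _ = covered
  ... | yes _ with covered? as y
  ...   | yes _ = covered
  ...   | no _ = there covered

  extend-covers : ∀ y as → norm y ≡ + (2 * m) → Covered (extend y as) y
  extend-covers y as norm-y with norm y ℤ.≟ + (2 * m)
  ... | no norm-y≢2m = contradiction norm-y norm-y≢2m
  ... | yes norm-y′ with covered? as y
  ...   | yes covered = covered
  ...   | no _ = here (lose (norm≡2⇒∈roots root (All.lookup pairing-roots-norm root∈pairing-roots))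
                            factor·root)
    where open Factorisation (factorise {m} y norm-y′)

  selection : List (ℍ ℤ)
  selection = foldr extend [] (box (2 * m))

  factor : Fin (length selection) → ℍ ℤ
  factor = List.lookup selection

  selection-admissible : Admissible selection
  selection-admissible = admissible (box (2 * m))
    where
    admissible : ∀ ys → Admissible (foldr extend [] ys)
    admissible [] = [] , []
    admissible (y ∷ ys) = extend-admissible y (admissible ys)

  norm-factor : ∀ i → norm (factor i) ≡ + m
  norm-factor i = All.lookup (proj₁ selection-admissible) (∈-lookup i)

  -- η-expanded so that Agda does not try to infer the implicit arguments through _·_.
  factors-disjoint : ∀ {i j} → i ≢ j → DisjointOrbits (factor i) (factor j)
  factors-disjoint =
    AllPairs-lookup (λ {a} {b} → DisjointOrbits-sym {a} {b}) (proj₂ selection-admissible)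

  factors-cover : ∀ y → norm y ≡ + (2 * m) → ∃ λ i → ∃ λ x → x ∈ roots × factor i · x ≡ y
  factors-cover y norm-y = Any.index covered , find (lookup-index covered)
    where
    covers : ∀ {ys} → y ∈ ys → Covered (foldr extend [] ys) y
    covers {_ ∷ ys} (here refl) = extend-covers y (foldr extend [] ys) norm-y
    covers {y′ ∷ _} (there y∈ys) = extend-monotone y′ (covers y∈ys)
    covered : Covered selection y
    covered = covers (∈-box y (∣coord∣≤norm y norm-y))

toℚ≡mkℚ : ∀ z → toℚ z ≡ ℚ.mkℚ z 0 (Coprime-sym (1-coprimeTo ℤ.∣ z ∣))
toℚ≡mkℚ z = ℚ.↥p/↧p≡p (ℚ.mkℚ z 0 (Coprime-sym (1-coprimeTo ℤ.∣ z ∣)))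

toℚ-+ : ∀ a b → toℚ (a ℤ.+ b) ≡ toℚ a ℚ.+ toℚ b
toℚ-+ a b = trans (ℚ./-cong {a ℤ.+ b} {1} {a ℤ.* + 1 ℤ.+ b ℤ.* + 1} {1}
                    (sym (cong₂ ℤ._+_ (ℤ.*-identityʳ a) (ℤ.*-identityʳ b))) refl)
                  (sym (cong₂ ℚ._+_ (toℚ≡mkℚ a) (toℚ≡mkℚ b)))

toℚ-* : ∀ a b → toℚ (a ℤ.* b) ≡ toℚ a ℚ.* toℚ b
toℚ-* a b = sym (cong₂ ℚ._*_ (toℚ≡mkℚ a) (toℚ≡mkℚ b))

toℚ-injective : ∀ {a b} → toℚ a ≡ toℚ b → a ≡ b
toℚ-injective {a} {b} toℚa≡toℚb = cong ℚ.↥_ (trans (sym (toℚ≡mkℚ a)) (trans toℚa≡toℚb (toℚ≡mkℚ b)))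

toℚ-Σ₄ : ∀ (u v : Vec4 ℤ) → sum4ℚ (λ j → toℚ (u j) ℚ.* toℚ (v j)) ≡ toℚ (Σ₄ λ j → u j ℤ.* v j)
toℚ-Σ₄ u v = sym (begin
  toℚ (p₀ ℤ.+ p₁ ℤ.+ p₂ ℤ.+ p₃)           ≡⟨ toℚ-+ (p₀ ℤ.+ p₁ ℤ.+ p₂) p₃ ⟩
  toℚ (p₀ ℤ.+ p₁ ℤ.+ p₂) ℚ.+ toℚ p₃        ≡⟨ cong (ℚ._+ toℚ p₃) (toℚ-+ (p₀ ℤ.+ p₁) p₂) ⟩
  toℚ (p₀ ℤ.+ p₁) ℚ.+ toℚ p₂ ℚ.+ toℚ p₃     ≡⟨ cong (λ q → q ℚ.+ toℚ p₂ ℚ.+ toℚ p₃) (toℚ-+ p₀ p₁) ⟩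
  toℚ p₀ ℚ.+ toℚ p₁ ℚ.+ toℚ p₂ ℚ.+ toℚ p₃  ≡⟨ cong₂ ℚ._+_ (cong₂ ℚ._+_ (cong₂ ℚ._+_
                                                 (toℚ-* (u i0) (v i0)) (toℚ-* (u i1) (v i1)))
                                                 (toℚ-* (u i2) (v i2))) (toℚ-* (u i3) (v i3)) ⟩
  sum4ℚ (λ j → toℚ (u j) ℚ.* toℚ (v j))     ∎)
  where
  open ≡-Reasoning
  p₀ = u i0 ℤ.* v i0; p₁ = u i1 ℤ.* v i1; p₂ = u i2 ℤ.* v i2; p₃ = u i3 ℤ.* v i3

leftMul : ℍ ℤ → Mat4
leftMul a i j = toℚ (coord (a · basis j) i)

apply-leftMul : ∀ a x c → apply (leftMul a) x c ≡ toℚ (coord (a · toℍ x) c)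
apply-leftMul a x c =
  trans (toℚ-Σ₄ (λ j → coord (a · basis j) c) x) (cong toℚ (·-basis-expansion a (toℍ x) c))

leftMul-gram : ∀ {m} a → norm a ≡ + m → ∀ i j →
  sum4ℚ (λ k → leftMul a k i ℚ.* leftMul a k j) ≡ toℚ (+ m ℤ.* dot (basis i) (basis j))
leftMul-gram a norm-a i j = trans (toℚ-Σ₄ (coord (a · basis i)) (coord (a · basis j)))
  (cong toℚ (trans (dot-·ˡ a (basis i) (basis j)) (cong (ℤ._* _) norm-a)))

leftMul-scaledOrth : ∀ {m} a → norm a ≡ + m → ScaledOrth m (leftMul a)
leftMul-scaledOrth {m} a norm-a i j with i ≟ j
... | yes refl = trans (leftMul-gram a norm-a i i)
  (cong toℚ (trans (cong (+ m ℤ.*_) (basis-normalised i)) (ℤ.*-identityʳ (+ m))))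
... | no i≢j = trans (leftMul-gram a norm-a i j)
  (cong toℚ (trans (cong (+ m ℤ.*_) (basis-orthogonal i≢j)) (ℤ.*-zeroʳ (+ m))))

leftMul-image : ∀ {m} a → norm a ≡ + m → ∀ x → InD4Shell 2 x →
  Σ (Vec4 ℤ) λ y → InD4Shell (2 * m) y × (∀ c → apply (leftMul a) x c ≡ toℚ (y c))
leftMul-image {m} a norm-a x (_ , norm-x) = coord (a · toℍ x)
  , norm⇒InD4Shell {m} (a · toℍ x) (norm-image a (toℍ x) norm-a norm-x)
  , apply-leftMul a x

leftMul-preimage : ∀ a y x → x ∈ roots → a · x ≡ toℍ y →
  InD4Shell 2 (coord x) × (∀ c → apply (leftMul a) (coord x) c ≡ toℚ (y c))
leftMul-preimage a y x x∈roots a·x≡y = norm⇒InD4Shell {1} x (All.lookup roots-norm x∈roots)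
  , λ c → trans (apply-leftMul a (coord x) c)
      (cong toℚ (trans (cong (λ z → coord z c) a·x≡y) (coord-toℍ y c)))

leftMul-disjoint : ∀ a b → DisjointOrbits a b → ∀ x x′ → InD4Shell 2 x → InD4Shell 2 x′ →
  ¬ (∀ c → apply (leftMul a) x c ≡ apply (leftMul b) x′ c)
leftMul-disjoint a b disjoint x x′ (_ , norm-x) (_ , norm-x′) ax≡bx′ =
  disjoint (toℍ x) (toℍ x′) (norm≡2⇒∈roots (toℍ x) norm-x) (norm≡2⇒∈roots (toℍ x′) norm-x′)
    (coord-injective λ c → toℚ-injective (begin
      toℚ (coord (a · toℍ x) c)    ≡⟨ apply-leftMul a x c ⟨
      apply (leftMul a) x c        ≡⟨ ax≡bx′ c ⟩
      apply (leftMul b) x′ c       ≡⟨ apply-leftMul b x′ c ⟩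
      toℚ (coord (b · toℍ x′) c)   ∎))
  where open ≡-Reasoning

theorem6p1 : (m : ℕ) → 1 ≤ m →
    Σ ℕ λ k → Σ (Fin k → Mat4) λ S →
      ((i : Fin k) → ScaledOrth m (S i))
      × ((y : Vec4 ℤ) → InD4Shell (2 * m) y →
           ∃ λ i → ∃ λ x → InD4Shell 2 x × (∀ c → apply (S i) x c ≡ toℚ (y c)))
      × ((i : Fin k) (x : Vec4 ℤ) → InD4Shell 2 x →
           Σ (Vec4 ℤ) λ y → InD4Shell (2 * m) y × (∀ c → apply (S i) x c ≡ toℚ (y c)))
      × ((i j : Fin k) → i ≢ j → (x x′ : Vec4 ℤ) → InD4Shell 2 x → InD4Shell 2 x′ →
           ¬ (∀ c → apply (S i) x c ≡ apply (S j) x′ c))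
theorem6p1 m _ = length selection , leftMul ∘ factor
  , (λ i → leftMul-scaledOrth (factor i) (norm-factor i))
  , covering
  , (λ i → leftMul-image (factor i) (norm-factor i))
  , (λ i j i≢j → leftMul-disjoint (factor i) (factor j) (factors-disjoint i≢j))
  where
  open Selection m
  covering : ∀ y → InD4Shell (2 * m) y →
    ∃ λ i → ∃ λ x → InD4Shell 2 x × (∀ c → apply (leftMul (factor i)) x c ≡ toℚ (y c))
  covering y (_ , norm-y) with factors-cover (toℍ y) norm-y
  ... | i , x , x∈roots , factor·x≡y =
    i , coord x , leftMul-preimage (factor i) y x x∈roots factor·x≡y
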